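{- Let $k\geq 2$ and $n\geq 1$ be integers with $nk$ even, and let $G$ be a complete balanced $k$-partite graph with $n$ vertices in each part. Then $W(G)\geq \left(\frac{3}{2}k-1\right)n-1$.
   Context: All graphs are finite, undirected, without loops or multiple edges. A complete $k$-partite graph is a graph whose vertex set is partitioned into $k$ independent sets $V_1,\ldots,V_k$ such that every vertex of $V_i$ is adjacent to every vertex of $V_j$ for all $i\neq j$; it is balanced if $|V_1|=\cdots=|V_k|$. An edge-coloring of a graph $G$ with colors $1,\ldots,t$ is an interval $t$-coloring if every color $1,\ldots,t$ is used on at least one edge, and for each vertex the colors of the edges incident to it are pairwise distinct and form a set of consecutive integers. $G$ is interval colorable if it has an interval $t$-coloring for some positive integer $t$; for an interval colorable $G$, $W(G)$ denotes the greatest $t$ such that $G$ has an interval $t$-coloring. (Such $G$ with $nk$ even is interval colorable.) -}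

module Defs where

open import Data.Nat using (ℕ; _≤_)
open import Data.Fin using (Fin)
open import Data.Product using (Σ; _×_; _,_; proj₁)
open import Data.Empty using (⊥)
open import Relation.Binary.PropositionalEquality using (_≡_; _≢_; refl; sym)

record Graph : Set₁ where
  field
    V      : Set
    Adj    : V → V → Set
    Adj-sym    : ∀ {u v} → Adj u v → Adj v u
    Adj-irrefl : ∀ {v} → Adj v v → ⊥
open Graph public

completeBalanced : (k n : ℕ) → Graph
completeBalanced k n = record
  { V          = Fin k × Fin n
  ; Adj        = λ u v → proj₁ u ≢ proj₁ v
  ; Adj-sym    = λ ne eq → ne (sym eq)
  ; Adj-irrefl = λ ne → ne refl
  }

-- An edge-colouring is a function c on ordered pairs of vertices; the colour
-- of the edge uv is c u v (required to equal c v u on edges; values on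
-- non-adjacent pairs are irrelevant).
-- c is an interval t-colouring of G if
--  * it is well defined on edges (symmetric),
--  * every edge gets a colour in {1,…,t},
--  * every colour 1,…,t is used on at least one edge,
--  * at each vertex, incident edges have pairwise distinct colours,
--  * at each vertex, the set of incident colours is a set of consecutive
--    integers: whenever p ≤ j ≤ q with p, q colours at v, j is a colour at v.
record IsIntervalColoring (G : Graph) (t : ℕ) (c : V G → V G → ℕ) : Set where
  field
    symmetric   : ∀ u v → Adj G u v → c u v ≡ c v u
    inRange     : ∀ u v → Adj G u v → 1 ≤ c u v × c u v ≤ t
    allUsed     : ∀ j → 1 ≤ j → j ≤ t → Σ (V G) λ u → Σ (V G) λ v → Adj G u v × c u v ≡ j
    proper      : ∀ v u w → Adj G v u → Adj G v w → c v u ≡ c v w → u ≡ w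
    consecutive : ∀ v u w j → Adj G v u → Adj G v w → c v u ≤ j → j ≤ c v w →
                  Σ (V G) λ x → Adj G v x × c v x ≡ j

HasIntervalColoring : Graph → ℕ → Set
HasIntervalColoring G t = Σ (V G → V G → ℕ) (IsIntervalColoring G t)

-- W(G) ≥ m  (for interval colourable G): G has an interval t-colouring for
-- some t ≥ m (W(G) is the greatest such t).
W≥ : Graph → ℕ → Set
W≥ G m = Σ ℕ λ t → m ≤ t × HasIntervalColoring G t

module Submission where

-- All colourings are built as window colourings: each vertex u has a window of D consecutive
-- colours starting at start u, and the colours at u are exactly the colours of this window
-- (the offset of an edge inside the window is a bijection with inverse neighbour u).
-- Shifting colours by one, such a colouring is an interval colouring (window⇒interval).
-- Three general operations act on window colourings:
--   * transport along graph isomorphisms;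
--   * blowUp-window: replacing every vertex by q+1 independent copies multiplies the window
--     length by q+1 and, in base q+1, gives t colours ↦ t(q+1) + q colours;
--   * remove-matching: deleting a perfect matching all of whose edges have one colour ℓ
--     (and closing the gap at ℓ) shortens windows and the colour range by one.
-- The base case is an explicit window colouring of K_{2(g+1)} with windows of length 2g+1
-- and 3g+1 colours, in which the antipodal perfect matching is monochromatic.
-- If k = 2(g+1) is even, K_{k×n} is the n-fold blow-up of K_{2(g+1)}; if n = 2(q+1) is even,
-- K_{k×n} is the (q+1)-fold blow-up of K_{k×2} = K_{2k} minus the antipodal matching.
-- In both cases the number of colours is exactly (3kn − 2n − 2)/2.

open import Defs
open import Data.Nat using (ℕ; _≤_; _+_; _*_; _∸_; _/_)
open import Data.Nat.Divisibility using (_∣_)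
open import Data.Nat using (zero; suc; pred; _<_; _%_; _≤?_; _<?_; _≟_; z≤n; s≤s; s<s; s≤s⁻¹; s<s⁻¹; NonZero)
open import Data.Nat.Properties
open import Data.Nat.DivMod
  using (_mod_; m≡m%n+[m/n]*n; m<n*o⇒m/o<n; m/n*n≤m; m*n/n≡m; m<n⇒m/n≡0; m<n⇒m%n≡m; m≤n⇒m%n≡m; m%n<n; [m+kn]%n≡m%n; +-distrib-/-∣ˡ)
open import Data.Nat.Divisibility using (divides; divides-refl)
open import Data.Nat.Primality using (euclidsLemma; prime[2])
open import Data.Nat.Tactic.RingSolver using (solve-∀)
open import Data.Fin using (Fin; toℕ; fromℕ; opposite; remQuot; combine)
open import Data.Fin.Properties
  using (toℕ<n; toℕ≤pred[n]; toℕ-fromℕ; toℕ-fromℕ<; toℕ-injective; opposite-prop; opposite-involutive; remQuot-combine; combine-remQuot; *↔×)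
open import Data.Product using (Σ; _×_; _,_; proj₁; proj₂)
open import Data.Sum using (_⊎_; inj₁; inj₂; [_,_]′)
open import Function using (_∘_)
open import Function.Bundles using (Inverse; _↔_; mk↔ₛ′)
open import Function.Properties.Inverse using (↔-trans)
open import Relation.Nullary using (yes; no; contradiction)
open import Relation.Binary.PropositionalEquality

-- A window colouring of G with windows of length D and t colours 0,…,t−1.  The edge uv
-- gets colour start u + offset u v; offset u is a bijection from the neighbours of u onto
-- 0,…,D−1 with inverse neighbour u.
record WindowColouring (G : Graph) (D t : ℕ) : Set where
  field
    start            : V G → ℕ
    offset           : V G → V G → ℕ
    neighbour        : V G → ℕ → V G
    colour-sym       : ∀ u v → Adj G u v → start u + offset u v ≡ start v + offset v u
    offset<D         : ∀ u v → Adj G u v → offset u v < D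
    neighbour-adj    : ∀ u r → r < D → Adj G u (neighbour u r)
    offset-neighbour : ∀ u r → r < D → offset u (neighbour u r) ≡ r
    neighbour-offset : ∀ u v → Adj G u v → neighbour u (offset u v) ≡ v
    end≤t            : ∀ u → start u + D ≤ t
    covered          : ∀ j → j < t → Σ (V G) λ u → start u ≤ j × j < start u + D

  colour : V G → V G → ℕ
  colour u v = start u + offset u v

  offset-injective : ∀ u v w → Adj G u v → Adj G u w → offset u v ≡ offset u w → v ≡ w
  offset-injective u v w uv uw eq = begin
    v                        ≡⟨ neighbour-offset u v uv ⟨
    neighbour u (offset u v) ≡⟨ cong (neighbour u) eq ⟩
    neighbour u (offset u w) ≡⟨ neighbour-offset u w uw ⟩
    w                        ∎
    where open ≡-Reasoning

  colour-in-window : ∀ u j → start u ≤ j → j < start u + D →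
                     Σ (V G) λ x → Adj G u x × colour u x ≡ j
  colour-in-window u j s≤j j<end =
    neighbour u r , neighbour-adj u r r<D ,
    trans (cong (start u +_) (offset-neighbour u r r<D)) (m+[n∸m]≡n s≤j)
    where
    r : ℕ
    r = j ∸ start u
    r<D : r < D
    r<D = subst (r <_) (m+n∸m≡n (start u) D) (∸-monoˡ-< j<end s≤j)

  window⇒interval : IsIntervalColoring G t (λ u v → suc (colour u v))
  window⇒interval = record
    { symmetric   = λ u v uv → cong suc (colour-sym u v uv)
    ; inRange     = λ u v uv → s≤s z≤n , ≤-trans (+-monoʳ-< (start u) (offset<D u v uv)) (end≤t u)
    ; allUsed     = allUsed
    ; proper      = λ v u w vu vw eq → offset-injective v u w vu vw (+-cancelˡ-≡ (start v) _ _ (suc-injective eq))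
    ; consecutive = consecutive
    }
    where
    allUsed : ∀ j → 1 ≤ j → j ≤ t →
              Σ (V G) λ u → Σ (V G) λ v → Adj G u v × suc (colour u v) ≡ j
    allUsed (suc j) _ j<t =
      let u , s≤j , j<end = covered j j<t
          x , ux , eq     = colour-in-window u j s≤j j<end
      in u , x , ux , cong suc eq
    consecutive : ∀ v u w j → Adj G v u → Adj G v w → suc (colour v u) ≤ j → j ≤ suc (colour v w) →
                  Σ (V G) λ x → Adj G v x × suc (colour v x) ≡ j
    consecutive v u w (suc j) vu vw (s≤s cu≤j) (s≤s j≤cw) =
      let x , vx , eq = colour-in-window v j (≤-trans (m≤m+n (start v) _) cu≤j)
                          (≤-<-trans j≤cw (+-monoʳ-< (start v) (offset<D v w vw)))
      in x , vx , cong suc eq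

  window⇒W≥ : ∀ {m} → m ≤ t → W≥ G m
  window⇒W≥ m≤t = t , m≤t , (λ u v → suc (colour u v)) , window⇒interval

infix 4 _≅_
record _≅_ (G H : Graph) : Set where
  field
    vertices : V G ↔ V H
    adj-to   : ∀ {u v} → Adj G u v → Adj H (Inverse.to vertices u) (Inverse.to vertices v)
    adj-from : ∀ {u v} → Adj H (Inverse.to vertices u) (Inverse.to vertices v) → Adj G u v
  open Inverse vertices public using (to; from; strictlyInverseˡ; strictlyInverseʳ)

≅-trans : ∀ {G H K} → G ≅ H → H ≅ K → G ≅ K
≅-trans G≅H H≅K = record
  { vertices = ↔-trans (_≅_.vertices G≅H) (_≅_.vertices H≅K)
  ; adj-to   = λ uv → _≅_.adj-to H≅K (_≅_.adj-to G≅H uv)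
  ; adj-from = λ uv → _≅_.adj-from G≅H (_≅_.adj-from H≅K uv)
  }

transport : ∀ {G H D t} → G ≅ H → WindowColouring H D t → WindowColouring G D t
transport {G} {H} {D} {t} G≅H W = record
  { start            = λ u → start (to u)
  ; offset           = λ u v → offset (to u) (to v)
  ; neighbour        = λ u r → from (neighbour (to u) r)
  ; colour-sym       = λ u v uv → colour-sym (to u) (to v) (adj-to uv)
  ; offset<D         = λ u v uv → offset<D (to u) (to v) (adj-to uv)
  ; neighbour-adj    = λ u r r<D → adj-from (subst (Adj H (to u)) (sym (strictlyInverseˡ _)) (neighbour-adj (to u) r r<D))
  ; offset-neighbour = λ u r r<D → trans (cong (offset (to u)) (strictlyInverseˡ _)) (offset-neighbour (to u) r r<D)
  ; neighbour-offset = λ u v uv → trans (cong from (neighbour-offset (to u) (to v) (adj-to uv))) (strictlyInverseʳ v)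
  ; end≤t            = λ u → end≤t (to u)
  ; covered          = λ j j<t → let y , in-window = covered j j<t
                                  in from y , subst (λ z → start z ≤ j × j < start z + D) (sym (strictlyInverseˡ y)) in-window
  }
  where
  open WindowColouring W
  open _≅_ G≅H

complete : Set → Graph
complete X = record
  { V          = X
  ; Adj        = λ u v → u ≢ v
  ; Adj-sym    = λ u≢v v≡u → u≢v (sym v≡u)
  ; Adj-irrefl = λ u≢u → u≢u refl
  }

blowUp : Graph → ℕ → Graph
blowUp G q = record
  { V          = V G × Fin q
  ; Adj        = λ u v → Adj G (proj₁ u) (proj₁ v)
  ; Adj-sym    = Adj-sym G
  ; Adj-irrefl = Adj-irrefl G
  }

complete-cong : ∀ {A B} → A ↔ B → complete A ≅ complete B
complete-cong A↔B = record
  { vertices = A↔B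
  ; adj-to   = λ u≢v eq → u≢v (trans (sym (strictlyInverseʳ _)) (trans (cong from eq) (strictlyInverseʳ _)))
  ; adj-from = λ fu≢fv eq → fu≢fv (cong to eq)
  }
  where open Inverse A↔B

blowUp-cong : ∀ {G H} q → G ≅ H → blowUp G q ≅ blowUp H q
blowUp-cong q G≅H = record
  { vertices = mk↔ₛ′ (λ (x , b) → to x , b) (λ (y , b) → from y , b)
                     (λ (y , b) → cong (_, b) (strictlyInverseˡ y)) (λ (x , b) → cong (_, b) (strictlyInverseʳ x))
  ; adj-to   = adj-to
  ; adj-from = adj-from
  }
  where open _≅_ G≅H

-- Splitting every part of size q·m into q blocks of size m exhibits K_{k×qm} as the
-- q-fold blow-up of K_{k×m}; note that completeBalanced k n is literally blowUp (complete (Fin k)) n.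
balanced-blowUp : ∀ k q m → completeBalanced k (q * m) ≅ blowUp (completeBalanced k m) q
balanced-blowUp k q m = record
  { vertices = mk↔ₛ′ (λ (i , a) → let (b , e) = remQuot {q} m a in (i , e) , b)
                     (λ ((i , e) , b) → i , combine b e)
                     (λ ((i , e) , b) → cong (λ (b′ , e′) → (i , e′) , b′) (remQuot-combine b e))
                     (λ (i , a) → cong (i ,_) (combine-remQuot {q} m a))
  ; adj-to   = λ i≢j → i≢j
  ; adj-from = λ i≢j → i≢j
  }

two-digit-< : ∀ {c e b Q} → c < e → b < Q → c * Q + b < e * Q
two-digit-< {c} {e} {b} {Q} c<e b<Q = begin-strict
  c * Q + b <⟨ +-monoʳ-< (c * Q) b<Q ⟩
  c * Q + Q ≡⟨ +-comm (c * Q) Q ⟩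
  suc c * Q ≤⟨ *-monoˡ-≤ Q c<e ⟩
  e * Q     ∎
  where open ≤-Reasoning

two-digit-quotient : ∀ c {b} Q .{{_ : NonZero Q}} → b < Q → (c * Q + b) / Q ≡ c
two-digit-quotient c {b} Q b<Q = begin
  (c * Q + b) / Q   ≡⟨ +-distrib-/-∣ˡ b (divides-refl c) ⟩
  c * Q / Q + b / Q ≡⟨ cong₂ _+_ (m*n/n≡m c Q) (m<n⇒m/n≡0 b<Q) ⟩
  c + 0             ≡⟨ +-identityʳ c ⟩
  c                 ∎
  where open ≡-Reasoning

two-digit-remainder : ∀ c {b} Q .{{_ : NonZero Q}} → b < Q → (c * Q + b) % Q ≡ b
two-digit-remainder c {b} Q b<Q = begin
  (c * Q + b) % Q ≡⟨ cong (_% Q) (+-comm (c * Q) b) ⟩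
  (b + c * Q) % Q ≡⟨ [m+kn]%n≡m%n b c Q ⟩
  b % Q           ≡⟨ m<n⇒m%n≡m b<Q ⟩
  b               ∎
  where open ≡-Reasoning

regroup : ∀ s o b b′ Q → s * Q + b + (o * Q + b′) ≡ (s + o) * Q + (b + b′)
regroup = solve-∀

window-end : ∀ s b D Q → s * Q + b + D * Q ≡ (s + D) * Q + b
window-end = solve-∀

-- The windows of the copies (x₀ , q) of a vertex whose window ends at t reach up to t·(q+1) + q.
blowUp-window : ∀ {G D t} (W : WindowColouring G D t) q → 1 ≤ D →
  (x₀ : V G) → WindowColouring.start W x₀ + D ≡ t →
  WindowColouring (blowUp G (suc q)) (D * suc q) (t * suc q + q)
blowUp-window {G} {D} {t} W q 1≤D x₀ x₀-last = record
  { start            = λ (x , b) → start x * Q + toℕ b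
  ; offset           = λ (x , _) (y , b′) → offset x y * Q + toℕ b′
  ; neighbour        = λ (x , _) r → neighbour x (r / Q) , r mod Q
  ; colour-sym       = λ (x , b) (y , b′) xy → begin-equality
      start x * Q + toℕ b + (offset x y * Q + toℕ b′) ≡⟨ regroup (start x) (offset x y) (toℕ b) (toℕ b′) Q ⟩
      colour x y * Q + (toℕ b + toℕ b′)               ≡⟨ cong₂ (λ c d → c * Q + d) (colour-sym x y xy) (+-comm (toℕ b) (toℕ b′)) ⟩
      colour y x * Q + (toℕ b′ + toℕ b)               ≡⟨ regroup (start y) (offset y x) (toℕ b′) (toℕ b) Q ⟨
      start y * Q + toℕ b′ + (offset y x * Q + toℕ b) ∎
  ; offset<D         = λ (x , _) (y , b′) xy → two-digit-< (offset<D x y xy) (toℕ<n b′)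
  ; neighbour-adj    = λ (x , _) r r<DQ → neighbour-adj x (r / Q) (m<n*o⇒m/o<n r<DQ)
  ; offset-neighbour = λ (x , _) r r<DQ → begin-equality
      offset x (neighbour x (r / Q)) * Q + toℕ (r mod Q)
        ≡⟨ cong₂ (λ o d → o * Q + d) (offset-neighbour x (r / Q) (m<n*o⇒m/o<n r<DQ)) (toℕ-fromℕ< _) ⟩
      r / Q * Q + r % Q ≡⟨ digits r ⟨
      r                 ∎
  ; neighbour-offset = λ (x , _) (y , b′) xy → cong₂ _,_
      (trans (cong (neighbour x) (two-digit-quotient (offset x y) Q (toℕ<n b′))) (neighbour-offset x y xy))
      (toℕ-injective (trans (toℕ-fromℕ< _) (two-digit-remainder (offset x y) Q (toℕ<n b′))))
  ; end≤t            = λ (x , b) → begin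
      start x * Q + toℕ b + D * Q ≡⟨ window-end (start x) (toℕ b) D Q ⟩
      (start x + D) * Q + toℕ b   ≤⟨ +-mono-≤ (*-monoˡ-≤ Q (end≤t x)) (toℕ≤pred[n] b) ⟩
      t * Q + q                   ∎
  ; covered          = covered′
  }
  where
  open WindowColouring W
  open ≤-Reasoning hiding (start)
  Q : ℕ
  Q = suc q

  digits : ∀ j → j ≡ j / Q * Q + j % Q
  digits j = trans (m≡m%n+[m/n]*n j Q) (+-comm (j % Q) _)

  -- j lies in the window of the first copy of a vertex covering the digit j / Q,
  -- or, when j / Q ≥ t, in the window of the last copy of x₀.
  covered′ : ∀ j → j < t * Q + q →
             Σ (V G × Fin Q) λ u → start (proj₁ u) * Q + toℕ (proj₂ u) ≤ j
                                 × j < start (proj₁ u) * Q + toℕ (proj₂ u) + D * Q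
  covered′ j j<end with j / Q <? t
  ... | yes j/Q<t =
    let x , s≤j/Q , j/Q<end = covered (j / Q) j/Q<t in
    (x , Fin.zero) ,
    (begin
      start x * Q + 0 ≡⟨ +-identityʳ _ ⟩
      start x * Q     ≤⟨ *-monoˡ-≤ Q s≤j/Q ⟩
      j / Q * Q       ≤⟨ m/n*n≤m j Q ⟩
      j               ∎) ,
    (begin-strict
      j                       ≡⟨ digits j ⟩
      j / Q * Q + j % Q       <⟨ two-digit-< j/Q<end (m%n<n j Q) ⟩
      (start x + D) * Q       ≡⟨ +-identityʳ _ ⟨
      (start x + D) * Q + 0   ≡⟨ window-end (start x) 0 D Q ⟨
      start x * Q + 0 + D * Q ∎)
  ... | no j/Q≮t =
    (x₀ , fromℕ q) ,
    (begin
      start x₀ * Q + toℕ (fromℕ q) ≡⟨ cong (start x₀ * Q +_) (toℕ-fromℕ q) ⟩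
      start x₀ * Q + q             <⟨ two-digit-< (n<1+n (start x₀)) (n<1+n q) ⟩
      suc (start x₀) * Q           ≤⟨ *-monoˡ-≤ Q x₀-below ⟩
      j / Q * Q                    ≤⟨ m/n*n≤m j Q ⟩
      j                            ∎) ,
    (begin-strict
      j                                    <⟨ j<end ⟩
      t * Q + q                            ≡⟨ cong (λ e → e * Q + q) x₀-last ⟨
      (start x₀ + D) * Q + q               ≡⟨ window-end (start x₀) q D Q ⟨
      start x₀ * Q + q + D * Q             ≡⟨ cong (λ d → start x₀ * Q + d + D * Q) (toℕ-fromℕ q) ⟨
      start x₀ * Q + toℕ (fromℕ q) + D * Q ∎)
    where
    x₀-below : suc (start x₀) ≤ j / Q
    x₀-below = begin
      suc (start x₀) ≡⟨ +-comm 1 (start x₀) ⟩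
      start x₀ + 1   ≤⟨ +-monoʳ-≤ (start x₀) 1≤D ⟩
      start x₀ + D   ≡⟨ x₀-last ⟩
      t              ≤⟨ ≮⇒≥ j/Q≮t ⟩
      j / Q          ∎

squeeze : ℕ → ℕ → ℕ
squeeze p x with x ≤? p
... | yes _ = x
... | no _  = pred x

unsqueeze : ℕ → ℕ → ℕ
unsqueeze p r with r <? p
... | yes _ = r
... | no _  = suc r

squeeze-≤ : ∀ {p x} → x ≤ p → squeeze p x ≡ x
squeeze-≤ {p} {x} x≤p with x ≤? p
... | yes _   = refl
... | no x≰p = contradiction x≤p x≰p

squeeze-> : ∀ {p x} → p < x → squeeze p x ≡ pred x
squeeze-> {p} {x} p<x with x ≤? p
... | yes x≤p = contradiction p<x (≤⇒≯ x≤p)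
... | no _    = refl

squeeze-unsqueeze : ∀ p r → squeeze p (unsqueeze p r) ≡ r
squeeze-unsqueeze p r with r <? p
... | yes r<p = squeeze-≤ (<⇒≤ r<p)
... | no r≮p  = squeeze-> (s≤s (≮⇒≥ r≮p))

unsqueeze-squeeze : ∀ p x → x ≢ p → unsqueeze p (squeeze p x) ≡ x
unsqueeze-squeeze p x x≢p with x ≤? p
unsqueeze-squeeze p x       x≢p | yes x≤p with x <? p
... | yes _   = refl
... | no x≮p = contradiction (≤∧≢⇒< x≤p x≢p) x≮p
unsqueeze-squeeze p (suc x) x≢p | no x≰p with x <? p
... | yes x<p = contradiction x<p (≤⇒≯ (s≤s⁻¹ (≰⇒> x≰p)))
... | no _    = refl
unsqueeze-squeeze p zero    x≢p | no x≰p = contradiction z≤n x≰p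

unsqueeze≢ : ∀ p r → unsqueeze p r ≢ p
unsqueeze≢ p r with r <? p
... | yes r<p = <⇒≢ r<p
... | no r≮p  = λ 1+r≡p → r≮p (subst (r <_) 1+r≡p ≤-refl)

unsqueeze-< : ∀ {D} p {r} → r < D → unsqueeze p r < suc D
unsqueeze-< p {r} r<D with r <? p
... | yes _ = m<n⇒m<1+n r<D
... | no _  = s<s r<D

squeeze-< : ∀ {D p x} → x ≢ p → x < suc D → p < suc D → squeeze p x < D
squeeze-< {D} {p} {x} x≢p x<1+D p<1+D with x ≤? p
squeeze-< {D} {p} {x}     x≢p x<1+D p<1+D | yes x≤p = <-≤-trans (≤∧≢⇒< x≤p x≢p) (s≤s⁻¹ p<1+D)
squeeze-< {D} {p} {suc x} x≢p x<1+D p<1+D | no _    = s<s⁻¹ x<1+D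
squeeze-< {D} {p} {zero}  x≢p x<1+D p<1+D | no x≰p  = contradiction z≤n x≰p

+-squeeze : ∀ s p x → s + squeeze p x ≡ squeeze (s + p) (s + x)
+-squeeze s p x with x ≤? p
+-squeeze s p x       | yes x≤p = sym (squeeze-≤ (+-monoʳ-≤ s x≤p))
+-squeeze s p (suc x) | no x≰p  = sym (trans (squeeze-> (+-monoʳ-< s (≰⇒> x≰p))) (cong pred (+-suc s x)))
+-squeeze s p zero    | no x≰p  = contradiction z≤n x≰p

record PerfectMatching (G : Graph) : Set where
  field
    partner            : V G → V G
    partner-involutive : ∀ u → partner (partner u) ≡ u
    partner-adj        : ∀ u → Adj G u (partner u)

infixl 6 _∖_
_∖_ : (G : Graph) → PerfectMatching G → Graph
G ∖ M = record
  { V          = V G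
  ; Adj        = λ u v → Adj G u v × v ≢ partner u
  ; Adj-sym    = λ {u} {v} (uv , v≢u′) →
      Adj-sym G uv , λ u≡v′ → v≢u′ (trans (sym (partner-involutive v)) (cong partner (sym u≡v′)))
  ; Adj-irrefl = λ (uu , _) → Adj-irrefl G uu
  }
  where open PerfectMatching M

-- If all edges of a perfect matching have the same colour ℓ, deleting them and closing
-- the gap at ℓ (colours above ℓ drop by one) shortens every window and the range by one.
remove-matching : ∀ {G D t} (W : WindowColouring G (suc D) (suc t)) (M : PerfectMatching G) ℓ →
  (∀ u → WindowColouring.colour W u (PerfectMatching.partner M u) ≡ ℓ) →
  WindowColouring (G ∖ M) D t
remove-matching {G} {D} {t} W M ℓ matched = record
  { start            = start
  ; offset           = λ u v → squeeze (gap u) (offset u v)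
  ; neighbour        = λ u r → neighbour u (unsqueeze (gap u) r)
  ; colour-sym       = λ u v (uv , _) → begin-equality
      start u + squeeze (gap u) (offset u v)      ≡⟨ +-squeeze (start u) (gap u) (offset u v) ⟩
      squeeze (colour u (partner u)) (colour u v) ≡⟨ cong₂ squeeze (trans (matched u) (sym (matched v))) (colour-sym u v uv) ⟩
      squeeze (colour v (partner v)) (colour v u) ≡⟨ +-squeeze (start v) (gap v) (offset v u) ⟨
      start v + squeeze (gap v) (offset v u)      ∎
  ; offset<D         = λ u v (uv , v≢u′) →
      squeeze-< (avoids-gap u v uv v≢u′) (offset<D u v uv) (offset<D u (partner u) (partner-adj u))
  ; neighbour-adj    = λ u r r<D →
      neighbour-adj u _ (unsqueeze-< (gap u) r<D) , λ eq → unsqueeze≢ (gap u) r (begin-equality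
        unsqueeze (gap u) r                          ≡⟨ offset-neighbour u _ (unsqueeze-< (gap u) r<D) ⟨
        offset u (neighbour u (unsqueeze (gap u) r)) ≡⟨ cong (offset u) eq ⟩
        gap u                                        ∎)
  ; offset-neighbour = λ u r r<D →
      trans (cong (squeeze (gap u)) (offset-neighbour u _ (unsqueeze-< (gap u) r<D))) (squeeze-unsqueeze (gap u) r)
  ; neighbour-offset = λ u v (uv , v≢u′) →
      trans (cong (neighbour u) (unsqueeze-squeeze (gap u) _ (avoids-gap u v uv v≢u′))) (neighbour-offset u v uv)
  ; end≤t            = λ u → s≤s⁻¹ (subst (_≤ suc t) (+-suc (start u) D) (end≤t u))
  ; covered          = covered′
  }
  where
  open WindowColouring W
  open PerfectMatching M
  open ≤-Reasoning hiding (start)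

  gap : V G → ℕ
  gap u = offset u (partner u)

  avoids-gap : ∀ u v → Adj G u v → v ≢ partner u → offset u v ≢ gap u
  avoids-gap u v uv v≢u′ eq = v≢u′ (offset-injective u v (partner u) uv (partner-adj u) eq)

  -- Every window contains ℓ; a colour j below ℓ keeps a window covering it, and
  -- a colour j ≥ ℓ is the image of j + 1, covered before the deletion.
  covered′ : ∀ j → j < t → Σ (V G) λ u → start u ≤ j × j < start u + D
  covered′ j j<t with j <? ℓ
  ... | yes j<ℓ =
    let u , s≤j , _ = covered j (m<n⇒m<1+n j<t) in
    u , s≤j , (begin-strict
      j               <⟨ j<ℓ ⟩
      ℓ               ≡⟨ matched u ⟨
      start u + gap u ≤⟨ +-monoʳ-≤ (start u) (s≤s⁻¹ (offset<D u (partner u) (partner-adj u))) ⟩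
      start u + D     ∎)
  ... | no j≮ℓ =
    let u , _ , 1+j<end = covered (suc j) (s<s j<t) in
    u , (begin
      start u         ≤⟨ m≤m+n (start u) (gap u) ⟩
      start u + gap u ≡⟨ matched u ⟩
      ℓ               ≤⟨ ≮⇒≥ j≮ℓ ⟩
      j               ∎) ,
    s<s⁻¹ (subst (suc j <_) (+-suc (start u) D) 1+j<end)

Doubled : ℕ → Set
Doubled m = Fin m × Fin 2

pattern L a = a , Fin.zero
pattern R a = a , Fin.suc Fin.zero

opposite-injective : ∀ {m} {i j : Fin m} → opposite i ≡ opposite j → i ≡ j
opposite-injective {i = i} {j} eq =
  trans (sym (opposite-involutive i)) (trans (cong opposite eq) (opposite-involutive j))

antipodal : ∀ m → PerfectMatching (complete (Doubled m))
antipodal m = record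
  { partner            = partner
  ; partner-involutive = involutive
  ; partner-adj        = λ { (L _) () ; (R _) () }
  }
  where
  partner : Doubled m → Doubled m
  partner (L a) = R (opposite a)
  partner (R a) = L (opposite a)
  involutive : ∀ u → partner (partner u) ≡ u
  involutive (L a) = cong (λ x → L x) (opposite-involutive a)
  involutive (R a) = cong (λ x → R x) (opposite-involutive a)

-- K_{m×2}, the complete m-partite graph with parts of size 2, is K_{2m} minus the
-- antipodal matching: the part {(i , 0), (i , 1)} becomes the matched pair L i, R (opposite i).
cocktail : ∀ m → completeBalanced m 2 ≅ complete (Doubled m) ∖ antipodal m
cocktail m = record
  { vertices = mk↔ₛ′ σ σ σ-involutive σ-involutive
  ; adj-to   = λ {u} {v} → separated u v
  ; adj-from = λ {u} {v} → unseparated u v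
  }
  where
  open PerfectMatching (antipodal m)
  σ : Doubled m → Doubled m
  σ (L i) = L i
  σ (R i) = R (opposite i)
  σ-involutive : ∀ u → σ (σ u) ≡ u
  σ-involutive (L i) = refl
  σ-involutive (R i) = cong (λ x → R x) (opposite-involutive i)
  separated : ∀ u v → proj₁ u ≢ proj₁ v → σ u ≢ σ v × σ v ≢ partner (σ u)
  separated (L i) (L j) i≢j = (λ eq → i≢j (cong proj₁ eq)) , (λ ())
  separated (L i) (R j) i≢j = (λ ()) , (λ eq → i≢j (sym (opposite-injective (cong proj₁ eq))))
  separated (R i) (L j) i≢j = (λ ()) , (λ eq → i≢j (trans (sym (opposite-involutive i)) (sym (cong proj₁ eq))))
  separated (R i) (R j) i≢j = (λ eq → i≢j (opposite-injective (cong proj₁ eq))) , (λ ())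
  unseparated : ∀ u v → σ u ≢ σ v × σ v ≢ partner (σ u) → proj₁ u ≢ proj₁ v
  unseparated (L _) (L _) (σu≢σv , _) refl = σu≢σv refl
  unseparated (L _) (R _) (_ , unmatched) refl = unmatched refl
  unseparated (R i) (L _) (_ , unmatched) refl = unmatched (cong (λ x → L x) (sym (opposite-involutive i)))
  unseparated (R _) (R _) (σu≢σv , _) refl = σu≢σv refl

-- halve r is inj₁ h when r = h + h and inj₂ h when r = 1 + h + h.
halve : ℕ → ℕ ⊎ ℕ
halve zero    = inj₁ zero
halve (suc r) = [ inj₂ , inj₁ ∘ suc ]′ (halve r)

double : ℕ ⊎ ℕ → ℕ
double (inj₁ h) = h + h
double (inj₂ h) = suc (h + h)

double-halve : ∀ r → double (halve r) ≡ r
double-halve zero    = refl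
double-halve (suc r) with halve r | double-halve r
... | inj₁ h | refl = refl
... | inj₂ h | refl = cong suc (+-suc h h)

halve-even : ∀ h → halve (h + h) ≡ inj₁ h
halve-odd  : ∀ h → halve (suc (h + h)) ≡ inj₂ h
halve-even zero    = refl
halve-even (suc h) rewrite +-suc h h | halve-odd h = refl
halve-odd h rewrite halve-even h = refl

half-≤ : ∀ {h g} → h + h ≤ g + g → h ≤ g
half-≤ {h} {g} h+h≤g+g with h ≤? g
... | yes h≤g = h≤g
... | no h≰g  = contradiction h+h≤g+g (<⇒≱ (+-mono-< (≰⇒> h≰g) (≰⇒> h≰g)))

half-< : ∀ {h g} → h + h < g + g → h < g
half-< {h} {g} h+h<g+g with h <? g
... | yes h<g = h<g
... | no h≮g  = contradiction h+h<g+g (≤⇒≯ (+-mono-≤ (≮⇒≥ h≮g) (≮⇒≥ h≮g)))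

-- Identities for the colour a + (g + 1 + b) of an edge L a — R (1+b).
crossing-sym : ∀ g a b → a + (suc g + b) ≡ suc b + (g + a)
crossing-sym = solve-∀

crossing-shift : ∀ g a b → a + (suc g + b) ≡ a + suc b + g
crossing-shift = solve-∀

-- A window colouring of K_{2(g+1)} with 3g+1 colours (counted from 0); a, a′ ≤ g, b, b′ < g:
--   L a — L a′ : a + a′          L a — R 0 : a + a          L a — R (1+b) : a + b + g + 1
--   R 0 — R (1+b) : 2b + 1       R (1+b) — R (1+b′) : b + b′ + 1
-- The window of L a and of R a is [a, a + 2g].  The hub R 0 supplies the colour a + a
-- missing at L a, and R (1+b) gets its colour b + b from the hub as well.
module CompleteGraphColouring (g : ℕ) where

  Vertex : Set
  Vertex = Doubled (suc g)

  D : ℕ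
  D = suc (g + g)

  toFin : ℕ → Fin (suc g)
  toFin m = m mod suc g

  toℕ-toFin : ∀ {m} → m ≤ g → toℕ (toFin m) ≡ m
  toℕ-toFin m≤g = trans (toℕ-fromℕ< _) (m≤n⇒m%n≡m m≤g)

  toFin-toℕ : ∀ a → toFin (toℕ a) ≡ a
  toFin-toℕ a = toℕ-injective (toℕ-toFin (toℕ≤pred[n] a))

  start : Vertex → ℕ
  start (a , _) = toℕ a

  offsetLR : ℕ → ℕ → ℕ
  offsetLR a zero    = a
  offsetLR a (suc b) = suc g + b

  offsetRL : ℕ → ℕ → ℕ
  offsetRL zero    a = a + a
  offsetRL (suc b) a = g + a

  offsetRR : ℕ → ℕ → ℕ
  offsetRR zero    zero     = zero
  offsetRR zero    (suc b′) = suc (b′ + b′)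
  offsetRR (suc b) zero     = b
  offsetRR (suc b) (suc b′) = b′

  offset : Vertex → Vertex → ℕ
  offset (L a) (L a′) = toℕ a′
  offset (L a) (R x)  = offsetLR (toℕ a) (toℕ x)
  offset (R x) (L a)  = offsetRL (toℕ x) (toℕ a)
  offset (R x) (R x′) = offsetRR (toℕ x) (toℕ x′)

  hubNeighbour : ℕ ⊎ ℕ → Vertex
  hubNeighbour (inj₁ h) = L (toFin h)
  hubNeighbour (inj₂ h) = R (toFin (suc h))

  neighbour : Vertex → ℕ → Vertex
  neighbour (L a) r with r ≤? g | r ≟ toℕ a
  ... | yes _ | yes _ = R Fin.zero
  ... | yes _ | no _  = L (toFin r)
  ... | no _  | _     = R (toFin (suc (r ∸ suc g)))
  neighbour (R Fin.zero) r = hubNeighbour (halve r)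
  neighbour (R (Fin.suc b)) r with r <? g | r ≟ toℕ b
  ... | yes _ | yes _ = R Fin.zero
  ... | yes _ | no _  = R (toFin (suc r))
  ... | no _  | _     = L (toFin (r ∸ g))

  colour : Vertex → Vertex → ℕ
  colour u v = start u + offset u v

  colour-sym : ∀ u v → u ≢ v → colour u v ≡ colour v u
  colour-sym (L a)           (L a′)           _   = +-comm (toℕ a) (toℕ a′)
  colour-sym (L a)           (R Fin.zero)     _   = refl
  colour-sym (L a)           (R (Fin.suc b))  _   = crossing-sym g (toℕ a) (toℕ b)
  colour-sym (R Fin.zero)    (L a)            _   = refl
  colour-sym (R (Fin.suc b)) (L a)            _   = sym (crossing-sym g (toℕ a) (toℕ b))
  colour-sym (R Fin.zero)    (R Fin.zero)     u≢u = contradiction refl u≢u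
  colour-sym (R Fin.zero)    (R (Fin.suc b′)) _   = refl
  colour-sym (R (Fin.suc b)) (R Fin.zero)     _   = refl
  colour-sym (R (Fin.suc b)) (R (Fin.suc b′)) _   = cong suc (+-comm (toℕ b) (toℕ b′))

  below-D : ∀ {m} → m ≤ g → m < D
  below-D m≤g = s≤s (≤-trans m≤g (m≤m+n g g))

  offset<D : ∀ u v → u ≢ v → offset u v < D
  offset<D (L a)           (L a′)           _   = below-D (toℕ≤pred[n] a′)
  offset<D (L a)           (R Fin.zero)     _   = below-D (toℕ≤pred[n] a)
  offset<D (L a)           (R (Fin.suc b))  _   = s≤s (+-monoʳ-< g (toℕ<n b))
  offset<D (R Fin.zero)    (L a)            _   = s≤s (+-mono-≤ (toℕ≤pred[n] a) (toℕ≤pred[n] a))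
  offset<D (R (Fin.suc b)) (L a)            _   = s≤s (+-monoʳ-≤ g (toℕ≤pred[n] a))
  offset<D (R Fin.zero)    (R Fin.zero)     u≢u = contradiction refl u≢u
  offset<D (R Fin.zero)    (R (Fin.suc b′)) _   = s≤s (+-mono-< (toℕ<n b′) (toℕ<n b′))
  offset<D (R (Fin.suc b)) (R Fin.zero)     _   = below-D (<⇒≤ (toℕ<n b))
  offset<D (R (Fin.suc b)) (R (Fin.suc b′)) _   = below-D (<⇒≤ (toℕ<n b′))

  high-index : ∀ {r} → suc g ≤ r → r < D → suc (r ∸ suc g) ≤ g
  high-index {r} g<r r<D = subst (r ∸ suc g <_) (m+n∸m≡n (suc g) g) (∸-monoˡ-< r<D g<r)

  low-index : ∀ {r} → r < D → r ∸ g ≤ g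
  low-index {r} r<D = subst (r ∸ g ≤_) (m+n∸m≡n g g) (∸-monoˡ-≤ g (s≤s⁻¹ r<D))

  even-index : ∀ {h r} → h + h ≡ r → r < D → h ≤ g
  even-index refl r<D = half-≤ (s≤s⁻¹ r<D)

  odd-index : ∀ {h r} → suc (h + h) ≡ r → r < D → suc h ≤ g
  odd-index refl r<D = half-< (s≤s⁻¹ r<D)

  neighbour-adj : ∀ u r → r < D → u ≢ neighbour u r
  neighbour-adj (L a) r r<D with r ≤? g | r ≟ toℕ a
  ... | yes _   | yes _  = λ ()
  ... | yes r≤g | no r≢a = λ a≡r → r≢a (trans (sym (toℕ-toFin r≤g)) (cong (toℕ ∘ proj₁) (sym a≡r)))
  ... | no _    | _      = λ ()
  neighbour-adj (R Fin.zero) r r<D with halve r | double-halve r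
  ... | inj₁ _ | _          = λ ()
  ... | inj₂ h | 1+h+h≡r = λ 0≡1+h → 0≢1+n (trans (cong (toℕ ∘ proj₁) 0≡1+h) (toℕ-toFin (odd-index 1+h+h≡r r<D)))
  neighbour-adj (R (Fin.suc b)) r r<D with r <? g | r ≟ toℕ b
  ... | yes _   | yes _  = λ ()
  ... | yes r<g | no r≢b = λ b≡r → r≢b (suc-injective (trans (sym (toℕ-toFin r<g)) (cong (toℕ ∘ proj₁) (sym b≡r))))
  ... | no _    | _      = λ ()

  offset-neighbour : ∀ u r → r < D → offset u (neighbour u r) ≡ r
  offset-neighbour (L a) r r<D with r ≤? g | r ≟ toℕ a
  ... | yes _   | yes r≡a = sym r≡a
  ... | yes r≤g | no _    = toℕ-toFin r≤g
  ... | no r≰g  | _       = trans (cong (offsetLR (toℕ a)) (toℕ-toFin (high-index (≰⇒> r≰g) r<D))) (m+[n∸m]≡n (≰⇒> r≰g))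
  offset-neighbour (R Fin.zero) r r<D with halve r | double-halve r
  ... | inj₁ h | h+h≡r   = trans (cong (λ m → m + m) (toℕ-toFin {h} (even-index h+h≡r r<D))) h+h≡r
  ... | inj₂ h | 1+h+h≡r = trans (cong (offsetRR 0) (toℕ-toFin (odd-index 1+h+h≡r r<D))) 1+h+h≡r
  offset-neighbour (R (Fin.suc b)) r r<D with r <? g | r ≟ toℕ b
  ... | yes _   | yes r≡b = sym r≡b
  ... | yes r<g | no _    = cong (offsetRR (toℕ (Fin.suc b))) (toℕ-toFin r<g)
  ... | no r≮g  | _       = trans (cong (offsetRL (toℕ (Fin.suc b))) (toℕ-toFin (low-index r<D))) (m+[n∸m]≡n (≮⇒≥ r≮g))

  neighbour-offset : ∀ u v → u ≢ v → neighbour u (offset u v) ≡ v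
  neighbour-offset (L a) (L a′) a≢a′ with toℕ a′ ≤? g | toℕ a′ ≟ toℕ a
  ... | yes _    | yes a′≡a = contradiction (cong (λ x → L x) (toℕ-injective (sym a′≡a))) a≢a′
  ... | yes _    | no _     = cong (λ x → L x) (toFin-toℕ a′)
  ... | no a′≰g | _        = contradiction (toℕ≤pred[n] a′) a′≰g
  neighbour-offset (L a) (R Fin.zero) _ with toℕ a ≤? g | toℕ a ≟ toℕ a
  ... | yes _   | yes _   = refl
  ... | yes _   | no a≢a = contradiction refl a≢a
  ... | no a≰g | _       = contradiction (toℕ≤pred[n] a) a≰g
  neighbour-offset (L a) (R (Fin.suc b)) _ with suc g + toℕ b ≤? g | suc g + toℕ b ≟ toℕ a
  ... | yes big≤g | _ = contradiction (≤-trans (m≤m+n (suc g) (toℕ b)) big≤g) 1+n≰n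
  ... | no _      | _ = cong (λ x → R x) (trans (cong (toFin ∘ suc) (m+n∸m≡n (suc g) (toℕ b))) (toFin-toℕ (Fin.suc b)))
  neighbour-offset (R Fin.zero) (L a) _ rewrite halve-even (toℕ a) = cong (λ x → L x) (toFin-toℕ a)
  neighbour-offset (R Fin.zero) (R Fin.zero) u≢u = contradiction refl u≢u
  neighbour-offset (R Fin.zero) (R (Fin.suc b′)) _ rewrite halve-odd (toℕ b′) = cong (λ x → R x) (toFin-toℕ (Fin.suc b′))
  neighbour-offset (R (Fin.suc b)) (L a) _ with g + toℕ a <? g | g + toℕ a ≟ toℕ b
  ... | yes big<g | _ = contradiction big<g (≤⇒≯ (m≤m+n g (toℕ a)))
  ... | no _      | _ = cong (λ x → L x) (trans (cong toFin (m+n∸m≡n g (toℕ a))) (toFin-toℕ a))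
  neighbour-offset (R (Fin.suc b)) (R Fin.zero) _ with toℕ b <? g | toℕ b ≟ toℕ b
  ... | yes _   | yes _   = refl
  ... | yes _   | no b≢b = contradiction refl b≢b
  ... | no b≮g | _       = contradiction (toℕ<n b) b≮g
  neighbour-offset (R (Fin.suc b)) (R (Fin.suc b′)) b≢b′ with toℕ b′ <? g | toℕ b′ ≟ toℕ b
  ... | yes _    | yes b′≡b = contradiction (cong (λ x → R (Fin.suc x)) (toℕ-injective (sym b′≡b))) b≢b′
  ... | yes _    | no _     = cong (λ x → R x) (toFin-toℕ (Fin.suc b′))
  ... | no b′≮g | _        = contradiction (toℕ<n b′) b′≮g

  T : ℕ
  T = suc (g + (g + g))

  last : Vertex
  last = L (fromℕ g)

  last-window : start last + D ≡ T
  last-window = trans (cong (_+ D) (toℕ-fromℕ g)) (+-suc g (g + g))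

  end≤T : ∀ u → start u + D ≤ T
  end≤T (a , _) = ≤-trans (+-monoˡ-≤ D (toℕ≤pred[n] a)) (≤-reflexive (+-suc g (g + g)))

  covered : ∀ j → j < T → Σ Vertex λ u → start u ≤ j × j < start u + D
  covered j j<T with j ≤? g
  ... | yes j≤g = L (toFin j) , ≤-reflexive (toℕ-toFin j≤g) ,
                  subst (λ s → j < s + D) (sym (toℕ-toFin j≤g)) (m<m+n j (s≤s z≤n))
  ... | no j≰g  = last , subst (_≤ j) (sym (toℕ-fromℕ g)) (<⇒≤ (≰⇒> j≰g)) ,
                  subst (j <_) (sym last-window) j<T

  window : WindowColouring (complete Vertex) D T
  window = record
    { start            = start
    ; offset           = offset
    ; neighbour        = neighbour
    ; colour-sym       = colour-sym
    ; offset<D         = offset<D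
    ; neighbour-adj    = neighbour-adj
    ; offset-neighbour = offset-neighbour
    ; neighbour-offset = neighbour-offset
    ; end≤t            = end≤T
    ; covered          = covered
    }

  antidiagonal : ∀ a x → toℕ a + toℕ x ≡ g → colour (L a) (R x) ≡ g + g
  antidiagonal a Fin.zero    a+0≡g   = cong (λ m → m + m) (trans (sym (+-identityʳ (toℕ a))) a+0≡g)
  antidiagonal a (Fin.suc b) a+1+b≡g = trans (crossing-shift g (toℕ a) (toℕ b)) (cong (_+ g) a+1+b≡g)

  antipodal-colour : ∀ u → colour u (PerfectMatching.partner (antipodal (suc g)) u) ≡ g + g
  antipodal-colour (L a) = antidiagonal a (opposite a)
    (trans (cong (toℕ a +_) (opposite-prop a)) (m+[n∸m]≡n (toℕ≤pred[n] a)))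
  antipodal-colour (R x) = trans (colour-sym (R x) (L (opposite x)) (λ ())) (antidiagonal (opposite x) x
    (trans (cong (_+ toℕ x) (opposite-prop x)) (m∸n+n≡m (toℕ≤pred[n] x))))

halved-difference : ∀ {a b t} → a ≡ t * 2 + b → (a ∸ b) / 2 ≤ t
halved-difference {b = b} {t} refl = ≤-reflexive (trans (cong (_/ 2) (m+n∸n≡m (t * 2) b)) (m*n/n≡m t 2))

-- The number of colours obtained in the two cases, written as 2t + (2n + 2).
count-even-parts : ∀ g n → 3 * (suc g * 2) * suc n ≡ (suc (g + (g + g)) * suc n + n) * 2 + (2 * suc n + 2)
count-even-parts = solve-∀

count-even-size : ∀ g q → 3 * suc g * (suc q * 2) ≡ ((g + (g + g)) * suc q + q) * 2 + (2 * (suc q * 2) + 2)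
count-even-size = solve-∀

even-part-count : ∀ g n →
  W≥ (completeBalanced (suc g * 2) (suc n)) ((3 * (suc g * 2) * suc n ∸ (2 * suc n + 2)) / 2)
even-part-count g n =
  WindowColouring.window⇒W≥ (transport iso blown) (halved-difference (count-even-parts g n))
  where
  open CompleteGraphColouring g
  blown : WindowColouring (blowUp (complete Vertex) (suc n)) (D * suc n) (T * suc n + n)
  blown = blowUp-window window n (s≤s z≤n) last last-window
  iso : completeBalanced (suc g * 2) (suc n) ≅ blowUp (complete Vertex) (suc n)
  iso = blowUp-cong (suc n) (complete-cong *↔×)

even-part-size : ∀ g q → 1 ≤ g →
  W≥ (completeBalanced (suc g) (suc q * 2)) ((3 * suc g * (suc q * 2) ∸ (2 * (suc q * 2) + 2)) / 2)
even-part-size g q 1≤g =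
  WindowColouring.window⇒W≥ (transport iso blown) (halved-difference (count-even-size g q))
  where
  open CompleteGraphColouring g
  reduced : WindowColouring (complete Vertex ∖ antipodal (suc g)) (g + g) (g + (g + g))
  reduced = remove-matching window (antipodal (suc g)) (g + g) antipodal-colour
  blown : WindowColouring (blowUp (complete Vertex ∖ antipodal (suc g)) (suc q))
                          ((g + g) * suc q) ((g + (g + g)) * suc q + q)
  blown = blowUp-window reduced q (≤-trans 1≤g (m≤m+n g g)) last (cong (_+ (g + g)) (toℕ-fromℕ g))
  iso : completeBalanced (suc g) (suc q * 2) ≅ blowUp (complete Vertex ∖ antipodal (suc g)) (suc q)
  iso = ≅-trans (balanced-blowUp (suc g) (suc q) 2) (blowUp-cong (suc q) (cocktail (suc g)))

-- Since 2 is prime, 2 ∣ n·k gives an even number of parts or parts of even size; the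
-- remaining cases (k < 2, n = 0, a zero quotient) contradict the hypotheses.
theorem7 : (k n : ℕ) → 2 ≤ k → 1 ≤ n → 2 ∣ n * k →
    W≥ (completeBalanced k n) ((3 * k * n ∸ (2 * n + 2)) / 2)
theorem7 k n 2≤k 1≤n 2∣nk with euclidsLemma n k prime[2] 2∣nk
theorem7 .(suc g * 2) (suc n) _ _ _ | inj₂ (divides (suc g) refl) = even-part-count g n
theorem7 (suc (suc g)) .(suc q * 2) _ _ _ | inj₁ (divides (suc q) refl) = even-part-size (suc g) q (s≤s z≤n)
theorem7 (suc zero) _ (s≤s ()) _ _ | _
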